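{- Let $k_1,\ldots,k_n\ge 2$ be integers, $G=[0,k_1-1]\times\cdots\times[0,k_n-1]$ and $N=\sum_{i=1}^n(k_i-1)$. If $d\in[0,N]$ and $E\subseteq[0,N]$ satisfy $d<\min E$, then \[ V_d(\underline{E})\subseteq\operatorname{span}\{\mathbb{Y}^{(\beta)}:\beta\in\underline{[d+1,d+|E|]}\}, \] where the polynomials on the right are viewed as functions on $\underline{E}$.
   Context: For integers $a\le b$, $[a,b]$ is the set of integers between $a$ and $b$; $\min\emptyset=+\infty$ by convention. For $x\in G$, $\mathrm{wt}(x)=\sum_i x_i$, and for a set of integers $F$, $\underline{F}=\{x\in G:\mathrm{wt}(x)\in F\}$. $V_d(A)$ is the real vector space of functions $A\to\mathbb{R}$ representable by a real polynomial of degree at most $d$. For $i\in[n]$ and $a\in\mathbb{N}$, $Y_i^{(a)}=X_i(X_i-1)\cdots(X_i-a+1)$, and $\mathbb{Y}^{(\beta)}=\prod_iY_i^{(\beta_i)}$.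
   Formalization: The functions in $V_d(\underline{E})$, the coefficients of the polynomials of degree at most $d$ and the coefficients of the span are rational rather than real. -}

module Defs where

open import Data.Nat as ℕ using (ℕ; zero; suc; _≤_; _<_; _∸_)
open import Data.Integer using (+_)
open import Data.Rational using (ℚ; 0ℚ; 1ℚ; _/_) renaming (_+_ to _+ℚ_; _*_ to _*ℚ_; _-_ to _-ℚ_)
open import Data.Fin using (Fin; zero; suc)
open import Data.List using (List; []; _∷_)
open import Data.List.Relation.Unary.All using (All)
open import Data.Product using (_×_; Σ; _,_; proj₁; proj₂)

Point : ℕ → Set
Point n = Fin n → ℕ

ι : ℕ → ℚ
ι m = (+ m) / 1

sumFin : ∀ {n} → (Fin n → ℕ) → ℕ
sumFin {zero} f = 0
sumFin {suc n} f = f zero ℕ.+ sumFin (λ i → f (suc i))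

prodFinℚ : ∀ {n} → (Fin n → ℚ) → ℚ
prodFinℚ {zero} f = 1ℚ
prodFinℚ {suc n} f = f zero *ℚ prodFinℚ (λ i → f (suc i))

powℚ : ℚ → ℕ → ℚ
powℚ q zero = 1ℚ
powℚ q (suc a) = powℚ q a *ℚ q

fall : ℚ → ℕ → ℚ
fall x zero = 1ℚ
fall x (suc a) = fall x a *ℚ (x -ℚ ι a)

wt : ∀ {n} → Point n → ℕ
wt x = sumFin x

InG : ∀ {n} → (Fin n → ℕ) → Point n → Set
InG k x = ∀ i → x i < k i

bigN : ∀ {n} → (Fin n → ℕ) → ℕ
bigN k = sumFin (λ i → k i ∸ 1)

PSet : ℕ → Set₁
PSet n = Point n → Set

monomial : ∀ {n} → Point n → Point n → ℚ
monomial α x = prodFinℚ (λ i → powℚ (ι (x i)) (α i))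

Ypoly : ∀ {n} → Point n → Point n → ℚ
Ypoly β x = prodFinℚ (λ i → fall (ι (x i)) (β i))

Poly : ℕ → Set
Poly n = List (ℚ × Point n)

evalPoly : ∀ {n} → Poly n → Point n → ℚ
evalPoly [] x = 0ℚ
evalPoly ((c , α) ∷ p) x = (c *ℚ monomial α x) +ℚ evalPoly p x

DegLe : ∀ {n} → ℕ → Poly n → Set
DegLe d p = All (λ t → wt (proj₂ t) ≤ d) p

InV : ∀ {n} → ℕ → PSet n → (Point n → ℚ) → Set
InV {n} d A f = Σ (Poly n) λ p → DegLe d p × (∀ x → A x → f x ≡ evalPoly p x)
  where open import Relation.Binary.PropositionalEquality using (_≡_)

evalYComb : ∀ {n} → List (ℚ × Point n) → Point n → ℚ
evalYComb [] x = 0ℚ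
evalYComb ((c , β) ∷ l) x = (c *ℚ Ypoly β x) +ℚ evalYComb l x

InYSpan : ∀ {n} → PSet n → PSet n → (Point n → ℚ) → Set
InYSpan {n} B A f = Σ (List (ℚ × Point n)) λ l → All (λ t → B (proj₂ t)) l × (∀ x → A x → f x ≡ evalYComb l x)
  where open import Relation.Binary.PropositionalEquality using (_≡_)

-- On G, (Xᵢ - βᵢ) 𝕐^(β) = 𝕐^(β+eᵢ), and 𝕐^(β+eᵢ) vanishes on G when βᵢ + 1 = kᵢ. Hence a monomial
-- of degree ≤ d is on G a combination of 𝕐^(γ) with γ ∈ G, wt γ ≤ d; and summing over i,
-- (wt X - wt β) 𝕐^(β) is a combination of 𝕐's in G of weight wt β + 1. Iterating, ρ(wt X) 𝕐^(γ)
-- with ρ(t) = (t - wt γ)⋯(t - d) lies in the span of weight exactly d + 1. As ρ has no root in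
-- E, Newton interpolation gives φ of degree < |E| with φ ρ = 1 on E; multiplying by φ(wt X)
-- spreads the weights over [d + 1, d + |E|] and gives a function equal to 𝕐^(γ) on E.
module Submission where

open import Defs
open import Data.Nat using (ℕ; _≤_; _<_; _+_; suc)
open import Data.Fin using (Fin)
open import Data.Rational using (ℚ)
open import Data.List using (List; length)
open import Data.List.Membership.Propositional using (_∈_)
open import Data.List.Relation.Unary.All using (All)
open import Data.List.Relation.Unary.Unique.Propositional using (Unique)
open import Data.Product using (_×_)

open import Function using (_∘_)
open import Algebra.Bundles using (Ring)
import Algebra.Properties.Group as GroupProperties
open import Data.Nat using (zero; pred; z≤n; s≤s; _∸_)
import Data.Nat.Properties as ℕ
import Data.Nat.Coprimality as Coprime
open import Data.Fin using (zero; suc; _≟_)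
open import Data.Vec.Functional using (updateAt)
open import Data.Vec.Functional.Properties using (updateAt-updates; updateAt-minimal)
import Data.Integer as ℤ
import Data.Integer.Properties as ℤ
open import Data.Rational using (0ℚ; 1ℚ; mkℚ; ↥_; 1/_; NonZero; ≢-nonZero)
  renaming (_+_ to _+ℚ_; _*_ to _*ℚ_; _-_ to _-ℚ_)
open import Data.Rational.Properties
  using (↥p/↧p≡p; /-cong; +-identityˡ; +-identityʳ; *-identityˡ; *-zeroˡ; *-zeroʳ;
         *-assoc; +-inverseʳ; *-inverseˡ; 1≢0; +-0-group; +-*-ring)
open import Data.Rational.Solver using (module +-*-Solver)
open import Data.List using ([]; _∷_; _++_; map; applyDownFrom)
open import Data.List.Relation.Unary.All using ([]; _∷_; lookup)
import Data.List.Relation.Unary.All as All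
open import Data.List.Relation.Unary.All.Properties using (++⁺; map⁺; applyDownFrom⁺₁)
open import Data.List.Relation.Unary.Any using (here; there)
open import Data.List.Relation.Unary.AllPairs using ([]; _∷_)
open import Data.Product using (Σ-syntax; ∃-syntax; _,_; proj₁; proj₂; map₁)
open import Data.Sum using (inj₁; inj₂)
open import Relation.Nullary using (yes; no)
open import Relation.Binary.PropositionalEquality
  using (_≡_; _≢_; refl; sym; trans; cong; cong₂; subst; module ≡-Reasoning)

open import Algebra.Properties.Semiring.Sum (Ring.semiring +-*-ring)
  using (sum; sum-cong-≗; *-distribʳ-sum)
open GroupProperties +-0-group using (x∙y⁻¹≈ε⇒x≈y)
open +-*-Solver

variable
  n : ℕ
  A A′ B B′ : PSet n
  f g : Point n → ℚ

ι≡mkℚ : ∀ m → ι m ≡ mkℚ (ℤ.+ m) 0 (Coprime.sym (Coprime.1-coprimeTo m))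
ι≡mkℚ m = ↥p/↧p≡p _

ι-homo-+ : ∀ m n → ι (m + n) ≡ ι m +ℚ ι n
ι-homo-+ m n rewrite ι≡mkℚ m | ι≡mkℚ n =
  /-cong (sym (cong₂ ℤ._+_ (ℤ.*-identityʳ (ℤ.+ m)) (ℤ.*-identityʳ (ℤ.+ n)))) refl

ι-injective : ∀ {m n} → ι m ≡ ι n → m ≡ n
ι-injective {m} {n} eq = ℤ.+-injective (cong ↥_ (trans (sym (ι≡mkℚ m)) (trans eq (ι≡mkℚ n))))

ι-ι≢0 : ∀ {m n} → m ≢ n → ι m -ℚ ι n ≢ 0ℚ
ι-ι≢0 m≢n eq = m≢n (ι-injective (x∙y⁻¹≈ε⇒x≈y _ _ eq))

*-≢0 : ∀ {p q} → p ≢ 0ℚ → q ≢ 0ℚ → p *ℚ q ≢ 0ℚ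
*-≢0 {p} {q} p≢0 q≢0 pq≡0 = q≢0 (begin
  q                    ≡⟨ sym (*-identityˡ q) ⟩
  1ℚ *ℚ q              ≡⟨ cong (_*ℚ q) (sym (*-inverseˡ p)) ⟩
  (1/ p *ℚ p) *ℚ q     ≡⟨ *-assoc (1/ p) p q ⟩
  1/ p *ℚ (p *ℚ q)     ≡⟨ cong (1/ p *ℚ_) pq≡0 ⟩
  1/ p *ℚ 0ℚ           ≡⟨ *-zeroʳ (1/ p) ⟩
  0ℚ                   ∎)
  where
  open ≡-Reasoning
  instance _ = ≢-nonZero p≢0

-- c = (1/r - φ)/π is the Newton coefficient at a new node, π being the value there of the
-- nodal polynomial of the previous nodes.
newton-step : ∀ φ r π .{{_ : NonZero r}} .{{_ : NonZero π}} →
              (((1/ r -ℚ φ) *ℚ 1/ π) *ℚ π +ℚ φ) *ℚ r ≡ 1ℚ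
newton-step φ r π = begin
  (((1/ r -ℚ φ) *ℚ 1/ π) *ℚ π +ℚ φ) *ℚ r  ≡⟨ cong (λ u → (u +ℚ φ) *ℚ r) (*-assoc (1/ r -ℚ φ) (1/ π) π) ⟩
  ((1/ r -ℚ φ) *ℚ (1/ π *ℚ π) +ℚ φ) *ℚ r  ≡⟨ cong (λ u → ((1/ r -ℚ φ) *ℚ u +ℚ φ) *ℚ r) (*-inverseˡ π) ⟩
  ((1/ r -ℚ φ) *ℚ 1ℚ +ℚ φ) *ℚ r           ≡⟨ solve 3 (λ s φ r → ((s :- φ) :* con 1ℚ :+ φ) :* r := s :* r) refl (1/ r) φ r ⟩
  1/ r *ℚ r                                ≡⟨ *-inverseˡ r ⟩
  1ℚ                                       ∎
  where open ≡-Reasoning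

sum-ι-ι : ∀ {n} (u v : Point n) → sum (λ i → ι (u i) -ℚ ι (v i)) ≡ ι (sumFin u) -ℚ ι (sumFin v)
sum-ι-ι {zero}  u v = sym (+-inverseʳ 0ℚ)
sum-ι-ι {suc n} u v = begin
  (ι u₀ -ℚ ι v₀) +ℚ sum (λ i → ι (u (suc i)) -ℚ ι (v (suc i)))  ≡⟨ cong ((ι u₀ -ℚ ι v₀) +ℚ_) (sum-ι-ι (u ∘ suc) (v ∘ suc)) ⟩
  (ι u₀ -ℚ ι v₀) +ℚ (ι U -ℚ ι V)
    ≡⟨ solve 4 (λ u₀ v₀ U V → (u₀ :- v₀) :+ (U :- V) := (u₀ :+ U) :- (v₀ :+ V)) refl (ι u₀) (ι v₀) (ι U) (ι V) ⟩
  (ι u₀ +ℚ ι U) -ℚ (ι v₀ +ℚ ι V)                                 ≡⟨ sym (cong₂ _-ℚ_ (ι-homo-+ u₀ U) (ι-homo-+ v₀ V)) ⟩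
  ι (u₀ + U) -ℚ ι (v₀ + V)                                        ∎
  where
  open ≡-Reasoning
  u₀ = u zero
  v₀ = v zero
  U = sumFin (u ∘ suc)
  V = sumFin (v ∘ suc)

sumFin≡0⇒≡0 : ∀ {n} (u : Point n) → sumFin u ≡ 0 → ∀ i → u i ≡ 0
sumFin≡0⇒≡0 u eq zero    = ℕ.m+n≡0⇒m≡0 (u zero) eq
sumFin≡0⇒≡0 u eq (suc i) = sumFin≡0⇒≡0 (u ∘ suc) (ℕ.m+n≡0⇒n≡0 (u zero) eq) i

sumFin≡suc⇒∃suc : ∀ {n m} (u : Point n) → sumFin u ≡ suc m → ∃[ i ] ∃[ a ] u i ≡ suc a
sumFin≡suc⇒∃suc {zero}  u ()
sumFin≡suc⇒∃suc {suc n} u eq with u zero in u₀≡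
... | suc a = zero , a , u₀≡
... | zero  with i , a , uᵢ≡ ← sumFin≡suc⇒∃suc (u ∘ suc) eq = suc i , a , uᵢ≡

wt-updateAt-suc : ∀ {n} (β : Point n) i → wt (updateAt β i suc) ≡ suc (wt β)
wt-updateAt-suc β zero    = refl
wt-updateAt-suc β (suc i) = trans (cong (β zero +_) (wt-updateAt-suc (β ∘ suc) i)) (ℕ.+-suc (β zero) _)

wt-updateAt-pred : ∀ {n a} (α : Point n) i → α i ≡ suc a → wt α ≡ suc (wt (updateAt α i pred))
wt-updateAt-pred α zero    eq rewrite eq = refl
wt-updateAt-pred α (suc i) eq =
  trans (cong (α zero +_) (wt-updateAt-pred (α ∘ suc) i eq)) (ℕ.+-suc (α zero) _)

InG-updateAt-suc : ∀ {n} (k : Fin n → ℕ) {β : Point n} i → InG k β → suc (β i) < k i → InG k (updateAt β i suc)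
InG-updateAt-suc k {β} i β∈G lt j with j ≟ i
... | yes refl = subst (_< k i) (sym (updateAt-updates i β)) lt
... | no j≢i   = subst (_< k j) (sym (updateAt-minimal j i β j≢i)) (β∈G j)

fall-vanishes : ∀ m a → m ≤ a → fall (ι m) (suc a) ≡ 0ℚ
fall-vanishes m a m≤a with ℕ.m≤n⇒m<n∨m≡n m≤a
... | inj₂ refl          = trans (cong (fall (ι m) m *ℚ_) (+-inverseʳ (ι m))) (*-zeroʳ (fall (ι m) m))
... | inj₁ (s≤s m≤a-1)   = trans (cong (_*ℚ (ι m -ℚ ι a)) (fall-vanishes m _ m≤a-1)) (*-zeroˡ (ι m -ℚ ι a))

prodFinℚ-cong : ∀ {n} (u v : Fin n → ℚ) → (∀ i → u i ≡ v i) → prodFinℚ u ≡ prodFinℚ v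
prodFinℚ-cong {zero}  u v eq = refl
prodFinℚ-cong {suc n} u v eq = cong₂ _*ℚ_ (eq zero) (prodFinℚ-cong (u ∘ suc) (v ∘ suc) (eq ∘ suc))

prodFinℚ-zero : ∀ {n} (u : Fin n → ℚ) i → u i ≡ 0ℚ → prodFinℚ u ≡ 0ℚ
prodFinℚ-zero u zero    eq = trans (cong (_*ℚ prodFinℚ (u ∘ suc)) eq) (*-zeroˡ (prodFinℚ (u ∘ suc)))
prodFinℚ-zero u (suc i) eq = trans (cong (u zero *ℚ_) (prodFinℚ-zero (u ∘ suc) i eq)) (*-zeroʳ (u zero))

Ypoly-updateAt-suc : ∀ {n} (β x : Point n) i → Ypoly (updateAt β i suc) x ≡ (ι (x i) -ℚ ι (β i)) *ℚ Ypoly β x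
Ypoly-updateAt-suc β x zero =
  solve 3 (λ F D R → (F :* D) :* R := D :* (F :* R)) refl
    (fall (ι (x zero)) (β zero)) (ι (x zero) -ℚ ι (β zero)) (Ypoly (β ∘ suc) (x ∘ suc))
Ypoly-updateAt-suc β x (suc i) = begin
  F *ℚ Ypoly (updateAt (β ∘ suc) i suc) (x ∘ suc)  ≡⟨ cong (F *ℚ_) (Ypoly-updateAt-suc (β ∘ suc) (x ∘ suc) i) ⟩
  F *ℚ (D *ℚ Ypoly (β ∘ suc) (x ∘ suc))           ≡⟨ solve 3 (λ F D R → F :* (D :* R) := D :* (F :* R)) refl F D _ ⟩
  D *ℚ (F *ℚ Ypoly (β ∘ suc) (x ∘ suc))           ∎
  where
  open ≡-Reasoning
  F = fall (ι (x zero)) (β zero)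
  D = ι (x (suc i)) -ℚ ι (β (suc i))

Ypoly-updateAt-suc-vanishes : ∀ {n} (β x : Point n) i → x i ≤ β i → Ypoly (updateAt β i suc) x ≡ 0ℚ
Ypoly-updateAt-suc-vanishes β x i xᵢ≤βᵢ = prodFinℚ-zero _ i
  (trans (cong (fall (ι (x i))) (updateAt-updates i β)) (fall-vanishes (x i) (β i) xᵢ≤βᵢ))

monomial-updateAt-pred : ∀ {n a} (α x : Point n) i → α i ≡ suc a →
                         monomial α x ≡ ι (x i) *ℚ monomial (updateAt α i pred) x
monomial-updateAt-pred {a = a} α x zero eq rewrite eq =
  solve 3 (λ P X R → (P :* X) :* R := X :* (P :* R)) refl
    (powℚ (ι (x zero)) a) (ι (x zero)) (monomial (α ∘ suc) (x ∘ suc))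
monomial-updateAt-pred α x (suc i) eq = begin
  P *ℚ monomial (α ∘ suc) (x ∘ suc)                              ≡⟨ cong (P *ℚ_) (monomial-updateAt-pred (α ∘ suc) (x ∘ suc) i eq) ⟩
  P *ℚ (X *ℚ monomial (updateAt (α ∘ suc) i pred) (x ∘ suc))    ≡⟨ solve 3 (λ P X R → P :* (X :* R) := X :* (P :* R)) refl P X _ ⟩
  X *ℚ (P *ℚ monomial (updateAt (α ∘ suc) i pred) (x ∘ suc))    ∎
  where
  open ≡-Reasoning
  P = powℚ (ι (x zero)) (α zero)
  X = ι (x (suc i))

monomial≡Ypoly-at-0 : ∀ {n} (α x : Point n) → (∀ i → α i ≡ 0) → monomial α x ≡ Ypoly α x
monomial≡Ypoly-at-0 α x α≡0 = trans
  (prodFinℚ-cong _ (λ _ → 1ℚ) (λ i → cong (powℚ (ι (x i))) (α≡0 i)))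
  (sym (prodFinℚ-cong _ (λ _ → 1ℚ) (λ i → cong (fall (ι (x i))) (α≡0 i))))

evalYComb-++ : ∀ {n} (l l′ : List (ℚ × Point n)) x → evalYComb (l ++ l′) x ≡ evalYComb l x +ℚ evalYComb l′ x
evalYComb-++ []            l′ x = sym (+-identityˡ _)
evalYComb-++ ((c , β) ∷ l) l′ x = trans (cong (c *ℚ Ypoly β x +ℚ_) (evalYComb-++ l l′ x))
  (solve 3 (λ u v w → u :+ (v :+ w) := (u :+ v) :+ w) refl (c *ℚ Ypoly β x) (evalYComb l x) (evalYComb l′ x))

evalYComb-scale : ∀ {n} c (l : List (ℚ × Point n)) x → evalYComb (map (map₁ (c *ℚ_)) l) x ≡ c *ℚ evalYComb l x
evalYComb-scale c []             x = sym (*-zeroʳ c)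
evalYComb-scale c ((c′ , β) ∷ l) x = trans (cong ((c *ℚ c′) *ℚ Ypoly β x +ℚ_) (evalYComb-scale c l x))
  (solve 4 (λ c c′ y e → (c :* c′) :* y :+ c :* e := c :* (c′ :* y :+ e)) refl c c′ (Ypoly β x) (evalYComb l x))

span-zero : InYSpan B A (λ _ → 0ℚ)
span-zero = [] , [] , λ _ _ → refl

span-basis : ∀ {β} → B β → InYSpan B A (Ypoly β)
span-basis {β = β} β∈B = (1ℚ , β) ∷ [] , β∈B ∷ [] , λ x _ → sym (trans (+-identityʳ _) (*-identityˡ (Ypoly β x)))

span-resp : (∀ x → A x → f x ≡ g x) → InYSpan B A f → InYSpan B A g
span-resp f≡g (l , l⊆B , f≡l) = l , l⊆B , λ x x∈A → trans (sym (f≡g x x∈A)) (f≡l x x∈A)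

span-mono : (∀ {β} → B β → B′ β) → InYSpan B A f → InYSpan B′ A f
span-mono B⊆B′ (l , l⊆B , f≡l) = l , All.map B⊆B′ l⊆B , f≡l

span-restrict : (∀ {x} → A′ x → A x) → InYSpan B A f → InYSpan B A′ f
span-restrict A′⊆A (l , l⊆B , f≡l) = l , l⊆B , λ x x∈A′ → f≡l x (A′⊆A x∈A′)

span-+ : InYSpan B A f → InYSpan B A g → InYSpan B A (λ x → f x +ℚ g x)
span-+ (l , l⊆B , f≡l) (l′ , l′⊆B , g≡l′) = l ++ l′ , ++⁺ l⊆B l′⊆B ,
  λ x x∈A → trans (cong₂ _+ℚ_ (f≡l x x∈A) (g≡l′ x x∈A)) (sym (evalYComb-++ l l′ x))

span-scale : ∀ c → InYSpan B A f → InYSpan B A (λ x → c *ℚ f x)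
span-scale c (l , l⊆B , f≡l) = map (map₁ (c *ℚ_)) l , map⁺ l⊆B ,
  λ x x∈A → trans (cong (c *ℚ_) (f≡l x x∈A)) (sym (evalYComb-scale c l x))

span-sum : ∀ {m} (F : Fin m → Point n → ℚ) → (∀ i → InYSpan B A (F i)) → InYSpan B A (λ x → sum (λ i → F i x))
span-sum {m = zero}  F F∈span = span-zero
span-sum {m = suc m} F F∈span = span-+ (F∈span zero) (span-sum (F ∘ suc) (F∈span ∘ suc))

span-mul : (h : Point n → ℚ) → (∀ {β} → B β → InYSpan B′ A (λ x → h x *ℚ Ypoly β x)) →
           InYSpan B A f → InYSpan B′ A (λ x → h x *ℚ f x)
span-mul {B = B} {B′ = B′} {A = A} h hY∈span (l , l⊆B , f≡l) =
  span-resp (λ x x∈A → cong (h x *ℚ_) (sym (f≡l x x∈A))) (combination l l⊆B)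
  where
  combination : ∀ l → All (B ∘ proj₂) l → InYSpan B′ A (λ x → h x *ℚ evalYComb l x)
  combination []            []          = span-resp (λ x _ → sym (*-zeroʳ (h x))) span-zero
  combination ((c , β) ∷ l) (β∈B ∷ l⊆B) = span-resp
    (λ x _ → solve 4 (λ c h y e → c :* (h :* y) :+ h :* e := h :* (c :* y :+ e)) refl c (h x) (Ypoly β x) (evalYComb l x))
    (span-+ (span-scale c (hY∈span β∈B)) (combination l l⊆B))

span-trans : (∀ {β} → B β → InYSpan B′ A (Ypoly β)) → InYSpan B A f → InYSpan B′ A f
span-trans Y∈span f∈span = span-resp (λ x _ → *-identityˡ _)
  (span-mul (λ _ → 1ℚ) (λ β∈B → span-resp (λ x _ → sym (*-identityˡ _)) (Y∈span β∈B)) f∈span)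

span-evalPoly : {P : Point n → Set} → (∀ {α} → P α → InYSpan B A (monomial α)) →
                ∀ p → All (P ∘ proj₂) p → InYSpan B A (evalPoly p)
span-evalPoly X∈span []            []          = span-zero
span-evalPoly X∈span ((c , α) ∷ p) (α∈P ∷ p⊆P) = span-+ (span-scale c (X∈span α∈P)) (span-evalPoly X∈span p p⊆P)

nodal : List ℕ → ℕ → ℚ
nodal []      t = 1ℚ
nodal (e ∷ L) t = (ι t -ℚ ι e) *ℚ nodal L t

nodal-root : ∀ {t} L → t ∈ L → nodal L t ≡ 0ℚ
nodal-root {t} (e ∷ L) (here refl) = trans (cong (_*ℚ nodal L t) (+-inverseʳ (ι t))) (*-zeroˡ (nodal L t))
nodal-root {t} (e ∷ L) (there t∈L) = trans (cong ((ι t -ℚ ι e) *ℚ_) (nodal-root L t∈L)) (*-zeroʳ (ι t -ℚ ι e))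

nodal-≢0 : ∀ {t} L → All (t ≢_) L → nodal L t ≢ 0ℚ
nodal-≢0 []      []          = 1≢0
nodal-≢0 (e ∷ L) (t≢e ∷ t∉L) = *-≢0 (ι-ι≢0 t≢e) (nodal-≢0 L t∉L)

module _ {n : ℕ} (k : Fin n → ℕ) where

  Layer : ℕ → PSet n
  Layer w β = InG k β × wt β ≡ w

  Band : ℕ → ℕ → PSet n
  Band a b β = InG k β × (a ≤ wt β × wt β ≤ b)

  Layer⊆Band : ∀ {a b w β} → a ≤ w → w ≤ b → Layer w β → Band a b β
  Layer⊆Band a≤w w≤b (β∈G , refl) = β∈G , a≤w , w≤b

  Band-mono : ∀ {a b b′ β} → b ≤ b′ → Band a b β → Band a b′ β
  Band-mono b≤b′ (β∈G , a≤wβ , wβ≤b) = β∈G , a≤wβ , ℕ.≤-trans wβ≤b b≤b′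

  span-Ypoly-updateAt-suc : ∀ {β} i → InG k β → InYSpan (Layer (suc (wt β))) (InG k) (Ypoly (updateAt β i suc))
  span-Ypoly-updateAt-suc {β} i β∈G with suc (β i) ℕ.<? k i
  ... | yes βᵢ+1<kᵢ = span-basis (InG-updateAt-suc k i β∈G βᵢ+1<kᵢ , wt-updateAt-suc β i)
  ... | no  βᵢ+1≮kᵢ = span-resp (λ x x∈G → sym (Ypoly-updateAt-suc-vanishes β x i
                        (ℕ.≤-pred (ℕ.≤-trans (x∈G i) (ℕ.≮⇒≥ βᵢ+1≮kᵢ))))) span-zero

  span-weight-step : ∀ {w β} → Layer w β → InYSpan (Layer (suc w)) (InG k) (λ x → (ι (wt x) -ℚ ι w) *ℚ Ypoly β x)
  span-weight-step {β = β} (β∈G , refl) =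
    span-resp Σ-steps (span-sum (λ i → Ypoly (updateAt β i suc)) (λ i → span-Ypoly-updateAt-suc i β∈G))
    where
    Σ-steps : ∀ x → InG k x → sum (λ i → Ypoly (updateAt β i suc) x) ≡ (ι (wt x) -ℚ ι (wt β)) *ℚ Ypoly β x
    Σ-steps x _ = begin
      sum (λ i → Ypoly (updateAt β i suc) x)           ≡⟨ sum-cong-≗ (Ypoly-updateAt-suc β x) ⟩
      sum (λ i → (ι (x i) -ℚ ι (β i)) *ℚ Ypoly β x)    ≡⟨ sym (*-distribʳ-sum (Ypoly β x) (λ i → ι (x i) -ℚ ι (β i))) ⟩
      sum (λ i → ι (x i) -ℚ ι (β i)) *ℚ Ypoly β x      ≡⟨ cong (_*ℚ Ypoly β x) (sum-ι-ι x β) ⟩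
      (ι (wt x) -ℚ ι (wt β)) *ℚ Ypoly β x              ∎
      where open ≡-Reasoning

  span-coordinate-mul : ∀ {β} i → InG k β → InYSpan (Band 0 (suc (wt β))) (InG k) (λ x → ι (x i) *ℚ Ypoly β x)
  span-coordinate-mul {β} i β∈G = span-resp split
    (span-+ (span-mono (Layer⊆Band z≤n ℕ.≤-refl) (span-Ypoly-updateAt-suc i β∈G))
            (span-scale (ι (β i)) (span-basis (β∈G , z≤n , ℕ.n≤1+n (wt β)))))
    where
    split : ∀ x → InG k x → Ypoly (updateAt β i suc) x +ℚ ι (β i) *ℚ Ypoly β x ≡ ι (x i) *ℚ Ypoly β x
    split x _ = trans (cong (_+ℚ ι (β i) *ℚ Ypoly β x) (Ypoly-updateAt-suc β x i))
      (solve 3 (λ X B Y → (X :- B) :* Y :+ B :* Y := X :* Y) refl (ι (x i)) (ι (β i)) (Ypoly β x))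

  span-monomial : (∀ i → 0 < k i) → ∀ α → InYSpan (Band 0 (wt α)) (InG k) (monomial α)
  span-monomial 0<k α = by-weight (wt α) α refl
    where
    by-weight : ∀ m α → wt α ≡ m → InYSpan (Band 0 m) (InG k) (monomial α)
    by-weight zero α wα≡0 = span-resp (λ x _ → sym (monomial≡Ypoly-at-0 α x α≡0))
      (span-basis ((λ i → subst (_< k i) (sym (α≡0 i)) (0<k i)) , z≤n , ℕ.≤-reflexive wα≡0))
      where α≡0 = sumFin≡0⇒≡0 α wα≡0
    by-weight (suc m) α wα≡1+m with i , a , αᵢ≡1+a ← sumFin≡suc⇒∃suc α wα≡1+m =
      span-resp (λ x _ → sym (monomial-updateAt-pred α x i αᵢ≡1+a))
        (span-mul (λ x → ι (x i))
          (λ (β∈G , _ , wβ≤m) → span-mono (Band-mono (s≤s wβ≤m)) (span-coordinate-mul i β∈G))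
          (by-weight m (updateAt α i pred) (ℕ.suc-injective (trans (sym (wt-updateAt-pred α i αᵢ≡1+a)) wα≡1+m))))

  span-weight-shift : ∀ {a b β} e → Band a b β → InYSpan (Band a (suc b)) (InG k) (λ x → (ι (wt x) -ℚ ι e) *ℚ Ypoly β x)
  span-weight-shift {β = β} e (β∈G , a≤wβ , wβ≤b) = span-resp split
    (span-+ (span-mono (Layer⊆Band (ℕ.m≤n⇒m≤1+n a≤wβ) (s≤s wβ≤b)) (span-weight-step (β∈G , refl)))
            (span-scale (ι (wt β) -ℚ ι e) (span-basis (β∈G , a≤wβ , ℕ.m≤n⇒m≤1+n wβ≤b))))
    where
    split : ∀ x → InG k x → (ι (wt x) -ℚ ι (wt β)) *ℚ Ypoly β x +ℚ (ι (wt β) -ℚ ι e) *ℚ Ypoly β x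
                            ≡ (ι (wt x) -ℚ ι e) *ℚ Ypoly β x
    split x _ = solve 4 (λ X B E Y → (X :- B) :* Y :+ (B :- E) :* Y := (X :- E) :* Y) refl
                  (ι (wt x)) (ι (wt β)) (ι e) (Ypoly β x)

  span-nodal : ∀ {a b} L → InYSpan (Band a b) (InG k) f →
               InYSpan (Band a (b + length L)) (InG k) (λ x → nodal L (wt x) *ℚ f x)
  span-nodal {b = b} [] f∈span =
    span-resp (λ x _ → sym (*-identityˡ _)) (span-mono (Band-mono (ℕ.m≤m+n b 0)) f∈span)
  span-nodal {f = f} {b = b} (e ∷ L) f∈span =
    span-resp (λ x _ → sym (*-assoc (ι (wt x) -ℚ ι e) (nodal L (wt x)) (f x)))
      (span-mul (λ x → ι (wt x) -ℚ ι e)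
        (λ β∈Band → span-mono (Band-mono (ℕ.≤-reflexive (sym (ℕ.+-suc b (length L))))) (span-weight-shift e β∈Band))
        (span-nodal L f∈span))

  span-Ypoly-to-layer : ∀ {γ} → InG k γ → ∀ j →
    InYSpan (Layer (wt γ + j)) (InG k) (λ x → nodal (applyDownFrom (wt γ +_) j) (wt x) *ℚ Ypoly γ x)
  span-Ypoly-to-layer {γ} γ∈G zero =
    span-resp (λ x _ → sym (*-identityˡ _)) (span-basis (γ∈G , sym (ℕ.+-identityʳ (wt γ))))
  span-Ypoly-to-layer {γ} γ∈G (suc j) =
    span-resp (λ x _ → sym (*-assoc (ι (wt x) -ℚ ι (wt γ + j)) (nodal (applyDownFrom (wt γ +_) j) (wt x)) (Ypoly γ x)))
      (span-mul (λ x → ι (wt x) -ℚ ι (wt γ + j))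
        (λ β∈Layer → span-mono (λ (β∈G , wβ≡) → β∈G , trans wβ≡ (sym (ℕ.+-suc (wt γ) j))) (span-weight-step β∈Layer))
        (span-Ypoly-to-layer γ∈G j))

  span-interpolate : ∀ {a b} (r : ℕ → ℚ) → InYSpan (Band a (suc b)) (InG k) g →
    ∀ E → Unique E → All (λ e → r e ≢ 0ℚ) E →
    Σ[ φ ∈ (ℕ → ℚ) ] InYSpan (Band a (b + length E)) (InG k) (λ x → φ (wt x) *ℚ g x) × All (λ e → φ e *ℚ r e ≡ 1ℚ) E
  span-interpolate {g = g} r g∈span [] _ _ = (λ _ → 0ℚ) , span-resp (λ x _ → sym (*-zeroˡ (g x))) span-zero , []
  span-interpolate {g = g} {a = a} {b = b} r g∈span (e ∷ E) (e∉E ∷ E-unique) (rₑ≢0 ∷ r≢0) =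
    extend (span-interpolate r g∈span E E-unique r≢0)
    where
    extend : Σ[ φ ∈ (ℕ → ℚ) ] InYSpan (Band a (b + length E)) (InG k) (λ x → φ (wt x) *ℚ g x) × All (λ e → φ e *ℚ r e ≡ 1ℚ) E →
             Σ[ ψ ∈ (ℕ → ℚ) ] InYSpan (Band a (b + suc (length E))) (InG k) (λ x → ψ (wt x) *ℚ g x) × All (λ e → ψ e *ℚ r e ≡ 1ℚ) (e ∷ E)
    extend (φ , φg∈span , φr≡1) = ψ , ψg∈span , newton-step (φ e) (r e) (nodal E e) ∷ All.tabulate ψr≡1
      where
      instance
        _ = ≢-nonZero rₑ≢0
        _ = ≢-nonZero (nodal-≢0 E e∉E)
      c : ℚ
      c = (1/ r e -ℚ φ e) *ℚ 1/ nodal E e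
      ψ : ℕ → ℚ
      ψ t = c *ℚ nodal E t +ℚ φ t
      b+|E|≤b+1+|E| = ℕ.+-monoʳ-≤ b (ℕ.n≤1+n (length E))
      ψg∈span : InYSpan (Band a (b + suc (length E))) (InG k) (λ x → ψ (wt x) *ℚ g x)
      ψg∈span = span-resp (λ x _ → solve 4 (λ c π g φ → c :* (π :* g) :+ φ :* g := (c :* π :+ φ) :* g) refl
                                             c (nodal E (wt x)) (g x) (φ (wt x)))
        (span-+ (span-scale c (span-mono (Band-mono (ℕ.≤-reflexive (sym (ℕ.+-suc b (length E))))) (span-nodal E g∈span)))
                (span-mono (Band-mono b+|E|≤b+1+|E|) φg∈span))
      ψr≡1 : ∀ {t} → t ∈ E → ψ t *ℚ r t ≡ 1ℚ
      ψr≡1 {t} t∈E = begin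
        (c *ℚ nodal E t +ℚ φ t) *ℚ r t  ≡⟨ cong (λ u → (c *ℚ u +ℚ φ t) *ℚ r t) (nodal-root E t∈E) ⟩
        (c *ℚ 0ℚ +ℚ φ t) *ℚ r t         ≡⟨ solve 3 (λ c φ r → (c :* con 0ℚ :+ φ) :* r := φ :* r) refl c (φ t) (r t) ⟩
        φ t *ℚ r t                       ≡⟨ lookup φr≡1 t∈E ⟩
        1ℚ                               ∎
        where open ≡-Reasoning

  span-Ypoly-on-weights : ∀ {d γ} E → Unique E → All (d <_) E → InG k γ → wt γ ≤ d →
    InYSpan (Band (suc d) (d + length E)) (λ x → InG k x × wt x ∈ E) (Ypoly γ)
  span-Ypoly-on-weights {d} {γ} E E-unique d<E γ∈G wγ≤d =
    conclude (span-interpolate ρ ρY∈span E E-unique (All.map ρ≢0 d<E))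
    where
    j = suc d ∸ wt γ
    nodes = applyDownFrom (wt γ +_) j
    ρ = nodal nodes
    wγ+j≡1+d : wt γ + j ≡ suc d
    wγ+j≡1+d = ℕ.m+[n∸m]≡n (ℕ.m≤n⇒m≤1+n wγ≤d)
    ρY∈span : InYSpan (Band (suc d) (suc d)) (InG k) (λ x → ρ (wt x) *ℚ Ypoly γ x)
    ρY∈span = span-mono (Layer⊆Band (ℕ.≤-reflexive (sym wγ+j≡1+d)) (ℕ.≤-reflexive wγ+j≡1+d)) (span-Ypoly-to-layer γ∈G j)
    ρ≢0 : ∀ {e} → d < e → ρ e ≢ 0ℚ
    ρ≢0 {e} d<e = nodal-≢0 nodes (applyDownFrom⁺₁ (wt γ +_) j λ i<j →
      ℕ.>⇒≢ (ℕ.<-≤-trans (ℕ.+-monoʳ-< (wt γ) i<j) (subst (_≤ e) (sym wγ+j≡1+d) d<e)))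
    conclude : Σ[ φ ∈ (ℕ → ℚ) ] InYSpan (Band (suc d) (d + length E)) (InG k) (λ x → φ (wt x) *ℚ (ρ (wt x) *ℚ Ypoly γ x))
                    × All (λ e → φ e *ℚ ρ e ≡ 1ℚ) E →
               InYSpan (Band (suc d) (d + length E)) (λ x → InG k x × wt x ∈ E) (Ypoly γ)
    conclude (φ , φρY∈span , φρ≡1) = span-resp φρY≡Y (span-restrict proj₁ φρY∈span)
      where
      φρY≡Y : ∀ x → InG k x × wt x ∈ E → φ (wt x) *ℚ (ρ (wt x) *ℚ Ypoly γ x) ≡ Ypoly γ x
      φρY≡Y x (_ , wx∈E) = begin
        φ (wt x) *ℚ (ρ (wt x) *ℚ Ypoly γ x)  ≡⟨ sym (*-assoc (φ (wt x)) (ρ (wt x)) (Ypoly γ x)) ⟩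
        (φ (wt x) *ℚ ρ (wt x)) *ℚ Ypoly γ x  ≡⟨ cong (_*ℚ Ypoly γ x) (lookup φρ≡1 wx∈E) ⟩
        1ℚ *ℚ Ypoly γ x                      ≡⟨ *-identityˡ (Ypoly γ x) ⟩
        Ypoly γ x                            ∎
        where open ≡-Reasoning

lemma4p2 : (n : ℕ) (k : Fin n → ℕ) → (∀ i → 2 ≤ k i)
    → (d : ℕ) → d ≤ bigN k
    → (E : List ℕ) → Unique E → All (λ e → e ≤ bigN k) E
    → All (λ e → d < e) E
    → (f : Point n → ℚ)
    → InV d (λ x → InG k x × wt x ∈ E) f
    → InYSpan (λ β → InG k β × (suc d ≤ wt β × wt β ≤ d + length E)) (λ x → InG k x × wt x ∈ E) f
lemma4p2 n k 2≤k d _ E E-unique _ d<E f (p , p-deg≤d , f≡p) =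
  span-resp (λ x x∈A → sym (f≡p x x∈A))
    (span-trans (λ (γ∈G , _ , wγ≤d) → span-Ypoly-on-weights k E E-unique d<E γ∈G wγ≤d)
      (span-evalPoly (λ {α} wα≤d → span-restrict proj₁ (span-mono (Band-mono k wα≤d) (span-monomial k 0<k α)))
        p p-deg≤d))
  where
  0<k : ∀ i → 0 < k i
  0<k i = ℕ.<-≤-trans (s≤s z≤n) (2≤k i)
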